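{- Let $2k+1$ be a prime and let $a,b,c,d$ be positive integers. The direct product $K_{a,b}\times K_{c,d}$ admits a $(2k+1)$-neighborhood balanced coloring if and only if $K_{a,b}$ admits a $(2k+1)$-neighborhood balanced coloring or $K_{c,d}$ admits a $(2k+1)$-neighborhood balanced coloring.
   Context: For a prime $2k+1$ (with $k\ge 1$), a $(2k+1)$-neighborhood balanced coloring of a finite simple graph is an assignment to each vertex of one of $2k+1$ colors $R_1,\dots,R_{2k+1}$ such that every vertex has an equal number of neighbors of each color. $K_{a,b}$ is the complete bipartite graph with parts of sizes $a$ and $b$. The direct product $G\times H$ has vertex set $V(G)\times V(H)$, with $(u,v)$ and $(u',v')$ adjacent if and only if $uu'\in E(G)$ and $vv'\in E(H)$. -}

module Defs where

open import Data.Nat using (ℕ; zero; suc; _+_; _*_)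
open import Data.Bool using (Bool; true; false; _∧_; not)
open import Data.Fin using (Fin; splitAt; remQuot; _≟_)
open import Data.Sum using (inj₁; inj₂)
open import Data.Product using (_,_; proj₁; proj₂)
open import Data.Nat.Primality using (Prime)
open import Relation.Binary.PropositionalEquality using (_≡_; refl; cong₂)
open import Relation.Nullary using (yes; no; does)

record Graph : Set where
  field
    n     : ℕ
    adj   : Fin n → Fin n → Bool
    sym   : ∀ u v → adj u v ≡ adj v u
    irrefl : ∀ v → adj v v ≡ false
open Graph public

count : ∀ {m} → (Fin m → Bool) → ℕ
count {zero}  P = 0
count {suc m} P = (if P Fin.zero then 1 else 0) + count (λ i → P (Fin.suc i))
  where open import Data.Bool using (if_then_else_)
        import Data.Fin as Fin

nbrCount : (G : Graph) {r : ℕ} → (Fin (n G) → Fin r) → Fin (n G) → Fin r → ℕ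
nbrCount G col v i = count (λ w → adj G v w ∧ does (col w ≟ i))

IsNbhdBalanced : (G : Graph) (r : ℕ) → (Fin (n G) → Fin r) → Set
IsNbhdBalanced G r col = ∀ v (i j : Fin r) → nbrCount G col v i ≡ nbrCount G col v j

AdmitsNBC : (r : ℕ) → Graph → Set
AdmitsNBC r G = Σ' (Fin (n G) → Fin r) (IsNbhdBalanced G r)
  where open import Data.Product using () renaming (Σ to Σ')

-- Complete bipartite graph K_{a,b} on Fin (a + b): the first a vertices form
-- one part, the last b vertices the other; adjacent iff in different parts.
side : ∀ {a b} → Fin (a + b) → Bool
side {a} x with splitAt a x
... | inj₁ _ = false
... | inj₂ _ = true

xor : Bool → Bool → Bool
xor true  y = not y
xor false y = y

xor-comm : ∀ x y → xor x y ≡ xor y x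
xor-comm true true = refl
xor-comm true false = refl
xor-comm false true = refl
xor-comm false false = refl

xor-self : ∀ x → xor x x ≡ false
xor-self true = refl
xor-self false = refl

K : ℕ → ℕ → Graph
K a b = record
  { n = a + b
  ; adj = λ u v → xor (side {a} {b} u) (side {a} {b} v)
  ; sym = λ u v → xor-comm (side {a} {b} u) (side {a} {b} v)
  ; irrefl = λ v → xor-self (side {a} {b} v)
  }

-- Direct (tensor/categorical) product G × H on Fin (n G * n H), where the
-- vertex x corresponds to the pair remQuot (n H) x.
_×ᴳ_ : Graph → Graph → Graph
G ×ᴳ H = record
  { n = n G * n H
  ; adj = λ x y → adj G (proj₁ (p x)) (proj₁ (p y)) ∧ adj H (proj₂ (p x)) (proj₂ (p y))
  ; sym = λ x y → cong₂ _∧_ (sym G (proj₁ (p x)) (proj₁ (p y))) (sym H (proj₂ (p x)) (proj₂ (p y)))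
  ; irrefl = λ x → irr (proj₁ (p x)) (proj₂ (p x))
  }
  where
    p : Fin (n G * n H) → _
    p = remQuot {n G} (n H)
    irr : ∀ u v → (adj G u u ∧ adj H v v) ≡ false
    irr u v rewrite irrefl G u = refl

{-# OPTIONS --safe #-}
-- Summing the r equal colour counts at a vertex shows that r divides every degree of a graph
-- with an r-neighbourhood balanced colouring. The degrees of K_{a,b} × K_{c,d} are the products
-- ac, ad, bc, bd, and a prime dividing all four divides both a and b or both c and d; in that
-- case each part of the corresponding factor splits into r colour classes of equal size.
-- Conversely, pulling a balanced colouring of one factor back along the projection multiplies
-- every colour count by the degree in the other factor, so it stays balanced.
module Submission where

open import Defs hiding (sym)
open import Algebra.Bundles using (CommutativeMonoid)
open import Data.Bool using (Bool; true; false; _∧_; if_then_else_)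
open import Data.Bool.Properties using (∧-assoc; ∧-identityʳ; ∧-commutativeMonoid)
open import Data.Fin using (Fin; zero; suc; _↑ˡ_; _↑ʳ_; splitAt; remQuot; quotient; remainder; combine; _≟_)
open import Data.Fin.Properties using (splitAt-↑ˡ; splitAt-↑ʳ; remQuot-combine; suc-injective)
open import Data.Nat using (ℕ; suc; _+_; _*_; _≤_)
open import Data.Nat.Divisibility using (_∣_; divides; _∣0; m∣m*n)
open import Data.Nat.Primality using (Prime; euclidsLemma)
open import Data.Nat.Properties using (+-assoc; +-identityʳ; *-identityʳ; *-distribʳ-+; +-0-commutativeMonoid)
open import Data.Product using (_×_; _,_; uncurry)
import Data.Product as Product
open import Data.Sum using (_⊎_; inj₁; inj₂; [_,_]′)
import Data.Sum as Sum
open import Data.Vec.Functional using (Vector)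
open import Function using (_∘_)
open import Function.Bundles using (_⇔_; mk⇔)
open import Relation.Binary.PropositionalEquality
  using (_≡_; _≢_; _≗_; refl; sym; trans; cong; cong₂; subst; module ≡-Reasoning)
open import Relation.Nullary using (does)
open import Relation.Nullary.Decidable using (dec-true; dec-false)
open import Algebra.Properties.CommutativeMonoid.Sum +-0-commutativeMonoid
  using (sum; sum-syntax; sum-replicate-zero; ∑-distrib-+)
open import Algebra.Properties.CommutativeSemigroup
  (CommutativeMonoid.commutativeSemigroup ∧-commutativeMonoid) using (xy∙z≈xz∙y)

𝟙 : Bool → ℕ
𝟙 b = if b then 1 else 0

degree : (G : Graph) → Fin (n G) → ℕ
degree G v = count (adj G v)

count-cong : ∀ {m} {P Q : Fin m → Bool} → P ≗ Q → count P ≡ count Q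
count-cong {ℕ.zero} P≗Q = refl
count-cong {suc m}  P≗Q = cong₂ _+_ (cong 𝟙 (P≗Q zero)) (count-cong (P≗Q ∘ suc))

count-false : ∀ m → count {m} (λ _ → false) ≡ 0
count-false ℕ.zero    = refl
count-false (suc m) = count-false m

count-true : ∀ m → count {m} (λ _ → true) ≡ m
count-true ℕ.zero    = refl
count-true (suc m) = cong suc (count-true m)

count≡∑ : ∀ {m} (P : Fin m → Bool) → count P ≡ ∑[ w < m ] 𝟙 (P w)
count≡∑ {ℕ.zero} P = refl
count≡∑ {suc m}  P = cong (𝟙 (P zero) +_) (count≡∑ (P ∘ suc))

count-∧ˡ : ∀ {m} b (P : Fin m → Bool) → count (λ w → b ∧ P w) ≡ 𝟙 b * count P
count-∧ˡ     true  P = sym (+-identityʳ (count P))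
count-∧ˡ {m} false P = count-false m

count-+ : ∀ a {b} (P : Fin (a + b) → Bool) →
          count P ≡ count (P ∘ (_↑ˡ b)) + count (P ∘ (a ↑ʳ_))
count-+ ℕ.zero    P = refl
count-+ (suc a) P =
  trans (cong (𝟙 (P zero) +_) (count-+ a (P ∘ suc))) (sym (+-assoc (𝟙 (P zero)) _ _))

remQuot-↑ʳ : ∀ {m} n (x : Fin (m * n)) →
             remQuot {suc m} n (n ↑ʳ x) ≡ Product.map₁ suc (remQuot {m} n x)
remQuot-↑ʳ {m} n x rewrite splitAt-↑ʳ n (m * n) x = refl

count-× : ∀ m n (P : Fin m → Bool) (Q : Fin n → Bool) →
          count {m * n} (λ x → P (quotient n x) ∧ Q (remainder {m} n x)) ≡ count P * count Q
count-× ℕ.zero    n P Q = refl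
count-× (suc m) n P Q = begin
  count PQ
    ≡⟨ count-+ n PQ ⟩
  count (PQ ∘ (_↑ˡ m * n)) + count (PQ ∘ (n ↑ʳ_))
    ≡⟨ cong₂ _+_ (count-cong (cong PQ′ ∘ remQuot-combine zero))
                 (count-cong (cong PQ′ ∘ remQuot-↑ʳ n)) ⟩
  count (λ j → P zero ∧ Q j) + count (λ x → P (suc (quotient n x)) ∧ Q (remainder {m} n x))
    ≡⟨ cong₂ _+_ (count-∧ˡ (P zero) Q) (count-× m n (P ∘ suc) Q) ⟩
  𝟙 (P zero) * count Q + count (P ∘ suc) * count Q
    ≡⟨ sym (*-distribʳ-+ (count Q) (𝟙 (P zero)) (count (P ∘ suc))) ⟩
  count P * count Q ∎
  where
  open ≡-Reasoning
  PQ′ : Fin (suc m) × Fin n → Bool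
  PQ′ (i , j) = P i ∧ Q j
  PQ : Fin (suc m * n) → Bool
  PQ = PQ′ ∘ remQuot n

count-singleton : ∀ {m} (P : Fin m → Bool) c →
                  P c ≡ true → (∀ i → i ≢ c → P i ≡ false) → count P ≡ 1
count-singleton {suc m} P zero Pc P≢c = cong₂ _+_ (cong 𝟙 Pc)
  (trans (count-cong (λ i → P≢c (suc i) λ ())) (count-false m))
count-singleton {suc m} P (suc c) Pc P≢c = cong₂ _+_ (cong 𝟙 (P≢c zero λ ()))
  (count-singleton (P ∘ suc) c Pc (λ i i≢c → P≢c (suc i) (i≢c ∘ suc-injective)))

count-≟ : ∀ {m} (c : Fin m) → count (λ i → does (i ≟ c)) ≡ 1
count-≟ c = count-singleton _ c (dec-true (c ≟ c) refl) (λ i i≢c → dec-false (i ≟ c) i≢c)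

∑-𝟙-≟ : ∀ {r} (c : Fin r) → ∑[ i < r ] 𝟙 (does (c ≟ i)) ≡ 1
∑-𝟙-≟ c = trans (sym (count≡∑ (λ i → does (c ≟ i))))
  (count-singleton _ c (dec-true (c ≟ c) refl) (λ i i≢c → dec-false (c ≟ i) (i≢c ∘ sym)))

∑-count-colour : ∀ {m r} (P : Fin m → Bool) (col : Fin m → Fin r) →
                 ∑[ i < r ] count (λ w → P w ∧ does (col w ≟ i)) ≡ count P
∑-count-colour {ℕ.zero} {r} P col = sum-replicate-zero r
∑-count-colour {suc m}  {r} P col = trans
  (∑-distrib-+ (λ i → 𝟙 (P zero ∧ does (col zero ≟ i))) _)
  (cong₂ _+_ (∑-𝟙-∧ (P zero)) (∑-count-colour (P ∘ suc) (col ∘ suc)))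
  where
  ∑-𝟙-∧ : ∀ b → ∑[ i < r ] 𝟙 (b ∧ does (col zero ≟ i)) ≡ 𝟙 b
  ∑-𝟙-∧ true  = ∑-𝟙-≟ (col zero)
  ∑-𝟙-∧ false = sum-replicate-zero r

∑-const : ∀ {r} {f : Vector ℕ r} c → (∀ i → f i ≡ c) → sum f ≡ r * c
∑-const {ℕ.zero}  c f≡c = refl
∑-const {suc r} c f≡c = cong₂ _+_ (f≡c zero) (∑-const c (f≡c ∘ suc))

∣-∑-balanced : ∀ {r} (f : Vector ℕ r) → (∀ i j → f i ≡ f j) → r ∣ sum f
∣-∑-balanced {ℕ.zero} f _   = 0 ∣0
∣-∑-balanced {suc r}  f bal =
  subst (suc r ∣_) (sym (∑-const (f zero) (λ i → bal i zero))) (m∣m*n (f zero))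

∣-degree : ∀ {r} G {col} → IsNbhdBalanced G r col → ∀ v → r ∣ degree G v
∣-degree {r} G {col} bal v =
  subst (r ∣_) (∑-count-colour (adj G v) col) (∣-∑-balanced (nbrCount G col v) (bal v))

nbrCount-×ˡ : ∀ {r} G H (col : Fin (n G) → Fin r) x i →
              nbrCount (G ×ᴳ H) (col ∘ quotient (n H)) x i
              ≡ nbrCount G col (quotient (n H) x) i * degree H (remainder {n G} (n H) x)
nbrCount-×ˡ G H col x i = begin
  count (λ w → (G∼ w ∧ H∼ w) ∧ colᵢ w)
    ≡⟨ count-cong (λ w → xy∙z≈xz∙y (G∼ w) (H∼ w) (colᵢ w)) ⟩
  count (λ w → (G∼ w ∧ colᵢ w) ∧ H∼ w)
    ≡⟨ count-× (n G) (n H) _ _ ⟩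
  nbrCount G col (q x) i * degree H (p x) ∎
  where
  open ≡-Reasoning
  q = quotient (n H)
  p = remainder {n G} (n H)
  G∼ H∼ colᵢ : Fin (n G * n H) → Bool
  G∼ w = adj G (q x) (q w)
  H∼ w = adj H (p x) (p w)
  colᵢ w = does (col (q w) ≟ i)

nbrCount-×ʳ : ∀ {r} G H (col : Fin (n H) → Fin r) x i →
              nbrCount (G ×ᴳ H) (col ∘ remainder {n G} (n H)) x i
              ≡ degree G (quotient (n H) x) * nbrCount H col (remainder {n G} (n H) x) i
nbrCount-×ʳ G H col x i = begin
  count (λ w → (G∼ w ∧ H∼ w) ∧ colᵢ w)
    ≡⟨ count-cong (λ w → ∧-assoc (G∼ w) (H∼ w) (colᵢ w)) ⟩
  count (λ w → G∼ w ∧ (H∼ w ∧ colᵢ w))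
    ≡⟨ count-× (n G) (n H) _ _ ⟩
  degree G (q x) * nbrCount H col (p x) i ∎
  where
  open ≡-Reasoning
  q = quotient (n H)
  p = remainder {n G} (n H)
  G∼ H∼ colᵢ : Fin (n G * n H) → Bool
  G∼ w = adj G (q x) (q w)
  H∼ w = adj H (p x) (p w)
  colᵢ w = does (col (p w) ≟ i)

×ᴳ-balancedˡ : ∀ {r} G H {col : Fin (n G) → Fin r} →
               IsNbhdBalanced G r col → IsNbhdBalanced (G ×ᴳ H) r (col ∘ quotient (n H))
×ᴳ-balancedˡ G H {col} bal x i j = begin
  nbrCount (G ×ᴳ H) (col ∘ quotient (n H)) x i  ≡⟨ nbrCount-×ˡ G H col x i ⟩
  nbrCount G col (q x) i * degree H (p x)        ≡⟨ cong (_* degree H (p x)) (bal (q x) i j) ⟩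
  nbrCount G col (q x) j * degree H (p x)        ≡⟨ nbrCount-×ˡ G H col x j ⟨
  nbrCount (G ×ᴳ H) (col ∘ quotient (n H)) x j  ∎
  where
  open ≡-Reasoning
  q = quotient (n H)
  p = remainder {n G} (n H)

×ᴳ-balancedʳ : ∀ {r} G H {col : Fin (n H) → Fin r} →
               IsNbhdBalanced H r col → IsNbhdBalanced (G ×ᴳ H) r (col ∘ remainder {n G} (n H))
×ᴳ-balancedʳ G H {col} bal x i j = begin
  nbrCount (G ×ᴳ H) (col ∘ p) x i          ≡⟨ nbrCount-×ʳ G H col x i ⟩
  degree G (q x) * nbrCount H col (p x) i  ≡⟨ cong (degree G (q x) *_) (bal (p x) i j) ⟩
  degree G (q x) * nbrCount H col (p x) j  ≡⟨ nbrCount-×ʳ G H col x j ⟨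
  nbrCount (G ×ᴳ H) (col ∘ p) x j          ∎
  where
  open ≡-Reasoning
  q = quotient (n H)
  p = remainder {n G} (n H)

degree-combine : ∀ G H u v → degree (G ×ᴳ H) (combine u v) ≡ degree G u * degree H v
degree-combine G H u v = trans
  (count-cong (λ w → cong (λ (u′ , v′) → adj G u′ (q w) ∧ adj H v′ (p w)) (remQuot-combine u v)))
  (count-× (n G) (n H) (adj G u) (adj H v))
  where
  q = quotient (n H)
  p = remainder {n G} (n H)

∣-degree-× : ∀ {r} G H {col} → IsNbhdBalanced (G ×ᴳ H) r col →
             ∀ u v → r ∣ degree G u * degree H v
∣-degree-× {r} G H {col} bal u v =
  subst (r ∣_) (degree-combine G H u v) (∣-degree (G ×ᴳ H) {col} bal (combine u v))

side-↑ˡ : ∀ a b (i : Fin a) → side {a} {b} (i ↑ˡ b) ≡ false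
side-↑ˡ a b i rewrite splitAt-↑ˡ a i b = refl

side-↑ʳ : ∀ a b (j : Fin b) → side {a} {b} (a ↑ʳ j) ≡ true
side-↑ʳ a b j rewrite splitAt-↑ʳ a b j = refl

count-opposite-side : ∀ a b s (P : Fin (a + b) → Bool) →
  count (λ w → xor s (side {a} {b} w) ∧ P w)
  ≡ (if s then count (P ∘ (_↑ˡ b)) else count (P ∘ (a ↑ʳ_)))
count-opposite-side a b s P = begin
  count (λ w → xor s (side {a} {b} w) ∧ P w)
    ≡⟨ count-+ a _ ⟩
  count (λ i → xor s (side {a} {b} (i ↑ˡ b)) ∧ P (i ↑ˡ b))
    + count (λ j → xor s (side {a} {b} (a ↑ʳ j)) ∧ P (a ↑ʳ j))
    ≡⟨ cong₂ _+_ (count-cong (λ i → cong (λ t → xor s t ∧ P (i ↑ˡ b)) (side-↑ˡ a b i)))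
                 (count-cong (λ j → cong (λ t → xor s t ∧ P (a ↑ʳ j)) (side-↑ʳ a b j))) ⟩
  count (λ i → xor s false ∧ P (i ↑ˡ b)) + count (λ j → xor s true ∧ P (a ↑ʳ j))
    ≡⟨ pick s ⟩
  (if s then count (P ∘ (_↑ˡ b)) else count (P ∘ (a ↑ʳ_))) ∎
  where
  open ≡-Reasoning
  pick : ∀ s → count (λ i → xor s false ∧ P (i ↑ˡ b)) + count (λ j → xor s true ∧ P (a ↑ʳ j))
               ≡ (if s then count (P ∘ (_↑ˡ b)) else count (P ∘ (a ↑ʳ_)))
  pick true  = trans (cong (count (P ∘ (_↑ˡ b)) +_) (count-false b)) (+-identityʳ _)
  pick false = cong (_+ count (P ∘ (a ↑ʳ_))) (count-false a)

degree-K : ∀ a b v → degree (K a b) v ≡ (if side {a} {b} v then a else b)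
degree-K a b v = begin
  count (adj (K a b) v)
    ≡⟨ count-cong (λ w → sym (∧-identityʳ (adj (K a b) v w))) ⟩
  count (λ w → xor s (side {a} {b} w) ∧ true)
    ≡⟨ count-opposite-side a b s (λ _ → true) ⟩
  (if s then count {a} (λ _ → true) else count {b} (λ _ → true))
    ≡⟨ cong₂ (if s then_else_) (count-true a) (count-true b) ⟩
  (if s then a else b) ∎
  where
  open ≡-Reasoning
  s = side {a} {b} v

degree-K-↑ˡ : ∀ a b i → degree (K a b) (i ↑ˡ b) ≡ b
degree-K-↑ˡ a b i = trans (degree-K a b (i ↑ˡ b)) (cong (if_then a else b) (side-↑ˡ a b i))

degree-K-↑ʳ : ∀ a b j → degree (K a b) (a ↑ʳ j) ≡ a
degree-K-↑ʳ a b j = trans (degree-K a b (a ↑ʳ j)) (cong (if_then a else b) (side-↑ʳ a b j))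

count-remainder-≟ : ∀ q {r} (i : Fin r) → count {q * r} (λ w → does (remainder {q} r w ≟ i)) ≡ q
count-remainder-≟ q {r} i = begin
  count {q * r} (λ w → true ∧ does (remainder {q} r w ≟ i))
    ≡⟨ count-× q r (λ _ → true) (λ j → does (j ≟ i)) ⟩
  count {q} (λ _ → true) * count (λ j → does (j ≟ i))
    ≡⟨ cong₂ _*_ (count-true q) (count-≟ i) ⟩
  q * 1
    ≡⟨ *-identityʳ q ⟩
  q ∎
  where open ≡-Reasoning

-- Each part is coloured by the residue of its index modulo r, so every colour occurs q times in
-- the first part and q′ times in the second.
K-admitsNBC : ∀ {r a b} → r ∣ a → r ∣ b → AdmitsNBC r (K a b)
K-admitsNBC {r} (divides q refl) (divides q′ refl) = col , balanced
  where
  a = q * r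
  b = q′ * r
  col : Fin (a + b) → Fin r
  col = [ remainder {q} r , remainder {q′} r ]′ ∘ splitAt a
  col-↑ˡ : ∀ j → col (j ↑ˡ b) ≡ remainder {q} r j
  col-↑ˡ j = cong [ remainder {q} r , remainder {q′} r ]′ (splitAt-↑ˡ a j b)
  col-↑ʳ : ∀ j → col (a ↑ʳ j) ≡ remainder {q′} r j
  col-↑ʳ j = cong [ remainder {q} r , remainder {q′} r ]′ (splitAt-↑ʳ a b j)
  colᵢ : Fin r → Fin (a + b) → Bool
  colᵢ i w = does (col w ≟ i)
  nbrCount≡ : ∀ v i → nbrCount (K a b) col v i ≡ (if side {a} {b} v then q else q′)
  nbrCount≡ v i = begin
    nbrCount (K a b) col v i
      ≡⟨ count-opposite-side a b s (colᵢ i) ⟩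
    (if s then count (colᵢ i ∘ (_↑ˡ b)) else count (colᵢ i ∘ (a ↑ʳ_)))
      ≡⟨ cong₂ (if s then_else_)
           (trans (count-cong (cong (λ c → does (c ≟ i)) ∘ col-↑ˡ)) (count-remainder-≟ q i))
           (trans (count-cong (cong (λ c → does (c ≟ i)) ∘ col-↑ʳ)) (count-remainder-≟ q′ i)) ⟩
    (if s then q else q′) ∎
    where
    open ≡-Reasoning
    s = side {a} {b} v
  balanced : IsNbhdBalanced (K a b) r col
  balanced v i j = trans (nbrCount≡ v i) (sym (nbrCount≡ v j))

prime∣products⇒∣pair : ∀ {p a b c d} → Prime p →
  p ∣ a * c → p ∣ a * d → p ∣ b * c → p ∣ b * d → (p ∣ a × p ∣ b) ⊎ (p ∣ c × p ∣ d)
prime∣products⇒∣pair {a = a} {b} {c} {d} p-prime ac ad bc bd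
  with euclidsLemma a c p-prime ac | euclidsLemma b d p-prime bd
... | inj₁ p∣a | inj₁ p∣b = inj₁ (p∣a , p∣b)
... | inj₂ p∣c | inj₂ p∣d = inj₂ (p∣c , p∣d)
... | inj₁ p∣a | inj₂ p∣d = Sum.map (p∣a ,_) (_, p∣d) (euclidsLemma b c p-prime bc)
... | inj₂ p∣c | inj₁ p∣b = Sum.map (_, p∣b) (p∣c ,_) (euclidsLemma a d p-prime ad)

admitsNBC-×ᴳ : ∀ {r} G H → AdmitsNBC r G ⊎ AdmitsNBC r H → AdmitsNBC r (G ×ᴳ H)
admitsNBC-×ᴳ G H (inj₁ (col , bal)) = col ∘ quotient (n H) , ×ᴳ-balancedˡ G H {col} bal
admitsNBC-×ᴳ G H (inj₂ (col , bal)) = col ∘ remainder {n G} (n H) , ×ᴳ-balancedʳ G H {col} bal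

admitsNBC-K×K⇒ : ∀ {p} → Prime p → ∀ a b c d →
  AdmitsNBC p (K (suc a) (suc b) ×ᴳ K (suc c) (suc d)) →
  AdmitsNBC p (K (suc a) (suc b)) ⊎ AdmitsNBC p (K (suc c) (suc d))
admitsNBC-K×K⇒ {p} p-prime a b c d (col , bal) =
  Sum.map (uncurry K-admitsNBC) (uncurry K-admitsNBC) (prime∣products⇒∣pair p-prime
    (p∣ (A ↑ʳ zero) (C ↑ʳ zero) (degree-K-↑ʳ A B zero) (degree-K-↑ʳ C D zero))
    (p∣ (A ↑ʳ zero) (zero ↑ˡ D) (degree-K-↑ʳ A B zero) (degree-K-↑ˡ C D zero))
    (p∣ (zero ↑ˡ B) (C ↑ʳ zero) (degree-K-↑ˡ A B zero) (degree-K-↑ʳ C D zero))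
    (p∣ (zero ↑ˡ B) (zero ↑ˡ D) (degree-K-↑ˡ A B zero) (degree-K-↑ˡ C D zero)))
  where
  A = suc a
  B = suc b
  C = suc c
  D = suc d
  p∣ : ∀ u v {x y} → degree (K A B) u ≡ x → degree (K C D) v ≡ y → p ∣ x * y
  p∣ u v refl refl = ∣-degree-× (K A B) (K C D) {col} bal u v

theorem2p10 : (k : ℕ) → Prime (2 * k + 1) → 1 ≤ k →
    (a b c d : ℕ) → 1 ≤ a → 1 ≤ b → 1 ≤ c → 1 ≤ d →
    AdmitsNBC (2 * k + 1) (K a b ×ᴳ K c d) ⇔ (AdmitsNBC (2 * k + 1) (K a b) ⊎ AdmitsNBC (2 * k + 1) (K c d))
theorem2p10 k p-prime _ (suc a) (suc b) (suc c) (suc d) _ _ _ _ =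
  mk⇔ (admitsNBC-K×K⇒ p-prime a b c d) (admitsNBC-×ᴳ (K (suc a) (suc b)) (K (suc c) (suc d)))
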